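{- Let $k\geq 3$, $\ell\geq 2$, $p\geq 2$, $t=\lfloor \frac{k-1}{2}\rfloor+\lfloor \frac{\ell-1}{2}\rfloor$, and let $n$ be sufficiently large. (i) If $k$ and $\ell$ are odd, $H(n,p,t+1)$ is $C_{k,\ell}^{p+1}$-free. (ii) If $k$ is odd and $\ell$ is even, $H(n,p,t+2)$ is $C_{k,\ell}^{p+1}$-free. (iii) If $k$ is even and $\ell$ is odd, every graph $H'(n,p,t+1)$ is $C_{k,\ell}^{p+1}$-free. (iv) If $k$ and $\ell$ are even, $H(n,p,t+2)$ is $C_{k,\ell}^{p+1}$-free.
   Context: All graphs are finite, simple, undirected. For a graph $H$ and integer $p\geq 2$, the edge blow-up $H^{p+1}$ is obtained from $H$ by replacing each edge by a clique of order $p+1$, where the new vertices of the different cliques are all distinct. The lollipop $C_{k,\ell}$ is obtained from a cycle $C_k$ by identifying one endpoint of a path $P_{\ell+1}$ (on $\ell+1$ vertices) with a vertex of the cycle. $T_p(n)$ is the $p$-partite Turán graph on $n$ vertices, $H(n,p,q)=K_{q-1}\vee T_p(n-q+1)$ ($\vee$ = join), and $H'(n,p,q)$ denotes any graph obtained from $H(n,p,q)$ by adding one extra edge inside one of the $p$ classes of $T_p(n-q+1)$. -}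

module Defs where

open import Data.Nat using (ℕ; zero; suc; _+_; _*_; _∸_; _≤_; _<_; NonZero; _≡ᵇ_; _<ᵇ_; _≤ᵇ_)
open import Data.Nat.DivMod using (_%_; _/_)
open import Data.Bool using (Bool; true; false; T; _∧_; _∨_)
open import Data.Fin using (Fin; toℕ)
open import Data.Product using (Σ; _×_; _,_)
open import Data.Sum using (_⊎_)
open import Relation.Binary.PropositionalEquality using (_≡_; _≢_)
open import Relation.Nullary using (¬_)
open import Function.Definitions using (Injective)

-- Lollipop C_{k,ℓ} on vertices 0 … k+ℓ-1:
--   cycle 0 - 1 - … - (k-1) - 0  on vertices < k,
--   path  0 - k - (k+1) - … - (k+ℓ-1)  (ℓ+1 vertices, sharing vertex 0
--   with the cycle).
lolAdjℕ : (k : ℕ) → ℕ → ℕ → Bool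
lolAdjℕ k i j = cyc ∨ path
  where
  cyc : Bool
  cyc = ((i <ᵇ k) ∧ (j <ᵇ k)) ∧
        ((j ≡ᵇ suc i) ∨ (i ≡ᵇ suc j) ∨
         ((i ≡ᵇ 0) ∧ (j ≡ᵇ (k ∸ 1))) ∨ ((j ≡ᵇ 0) ∧ (i ≡ᵇ (k ∸ 1))))
  path : Bool
  path = ((i ≡ᵇ 0) ∧ (j ≡ᵇ k)) ∨ ((j ≡ᵇ 0) ∧ (i ≡ᵇ k)) ∨
         ((k ≤ᵇ i) ∧ (j ≡ᵇ suc i)) ∨ ((k ≤ᵇ j) ∧ (i ≡ᵇ suc j))

lollipopAdj : (k ℓ : ℕ) → Fin (k + ℓ) → Fin (k + ℓ) → Bool
lollipopAdj k ℓ i j = lolAdjℕ k (toℕ i) (toℕ j)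

-- Edge blow-up F^{p+1} of a graph F on Fin m with Boolean adjacency:
-- every edge {a,b} (listed once, as a < b) gets p-1 fresh vertices,
-- which together with a and b form a clique of order p+1.

BlowVertex : (m : ℕ) → (Fin m → Fin m → Bool) → ℕ → Set
BlowVertex m adj p =
  Fin m ⊎ Σ (Fin m × Fin m) (λ { (a , b) →
     T (adj a b ∧ (toℕ a <ᵇ toℕ b)) × Fin (p ∸ 1) })

data BlowAdj (m : ℕ) (adj : Fin m → Fin m → Bool) (p : ℕ) :
             BlowVertex m adj p → BlowVertex m adj p → Set where
  orig-orig : ∀ {a b} → T (adj a b) →
              BlowAdj m adj p (Data.Sum.inj₁ a) (Data.Sum.inj₁ b)
  orig-new  : ∀ {a x y e r} → (a ≡ x ⊎ a ≡ y) →
              BlowAdj m adj p (Data.Sum.inj₁ a) (Data.Sum.inj₂ ((x , y) , e , r))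
  new-orig  : ∀ {a x y e r} → (a ≡ x ⊎ a ≡ y) →
              BlowAdj m adj p (Data.Sum.inj₂ ((x , y) , e , r)) (Data.Sum.inj₁ a)
  new-new   : ∀ {x y e e′ r r′} → r ≢ r′ →
              BlowAdj m adj p (Data.Sum.inj₂ ((x , y) , e , r))
                              (Data.Sum.inj₂ ((x , y) , e′ , r′))

Contains : {W : Set} → (W → W → Set) → (n : ℕ) → (Fin n → Fin n → Set) → Set
Contains {W} R n A =
  Σ (W → Fin n) λ f → Injective _≡_ _≡_ f × (∀ x y → R x y → A (f x) (f y))

Free : {W : Set} → (W → W → Set) → (n : ℕ) → (Fin n → Fin n → Set) → Set
Free R n A = ¬ Contains R n A

LollipopBlowupFree : (k ℓ p n : ℕ) → (Fin n → Fin n → Set) → Set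
LollipopBlowupFree k ℓ p n A = Free (BlowAdj (k + ℓ) (lollipopAdj k ℓ) p) n A

-- H(n,p,q) = K_{q-1} ∨ T_p(n-q+1) on Fin n: vertices 0 … q-2 form the
-- clique K_{q-1}; vertex i ≥ q-1 lies in Turán class (i - (q-1)) mod p.
turanClass : (p q : ℕ) → .{{_ : NonZero p}} → ℕ → ℕ
turanClass p q i = (i ∸ (q ∸ 1)) % p

HAdj : (n p q : ℕ) → .{{_ : NonZero p}} → Fin n → Fin n → Set
HAdj n p q i j =
  i ≢ j × (toℕ i < q ∸ 1 ⊎ toℕ j < q ∸ 1 ⊎
           turanClass p q (toℕ i) ≢ turanClass p q (toℕ j))

-- H(n,p,q) plus the extra edge uv (u, v distinct, in the same class of
-- T_p(n-q+1)); H'(n,p,q) ranges over all such graphs.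
H′Adj : (n p q : ℕ) → .{{_ : NonZero p}} → (u v : Fin n) → Fin n → Fin n → Set
H′Adj n p q u v i j = HAdj n p q i j ⊎ ((i ≡ u × j ≡ v) ⊎ (i ≡ v × j ≡ u))

IsH′Edge : (n p q : ℕ) → .{{_ : NonZero p}} → (u v : Fin n) → Set
IsH′Edge n p q u v =
  u ≢ v × (q ∸ 1 ≤ toℕ u) × (q ∸ 1 ≤ toℕ v) ×
  turanClass p q (toℕ u) ≡ turanClass p q (toℕ v)

tval : ℕ → ℕ → ℕ
tval k ℓ = (k ∸ 1) / 2 + (ℓ ∸ 1) / 2

-- A clique of order p + 1 in H(n,p,q) must meet the core K_{q−1}, since the
-- other vertices form a p-partite graph. In an embedded C_{k,ℓ}^{p+1} every edge
-- of C_{k,ℓ} becomes such a clique, and cliques of disjoint edges are disjoint, so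
-- a matching of C_{k,ℓ} yields as many distinct core vertices as it has edges.
-- For odd k the clique of the closing edge 0(k−1) gives one more: its core vertex
-- belongs to 0 or to k−1, and the remaining k − 1 cycle vertices still carry a
-- matching of size (k−1)/2. Together with ⌊ℓ/2⌋ path edges this exceeds q − 1 in
-- cases (i), (ii) and (iv). In case (iii) a clique may instead contain the extra
-- edge uv, but two cliques share at most one vertex, so at most one edge of
-- C_{k,ℓ} carries uv; since C_{k,ℓ} has two edge-disjoint matchings of size t + 1
-- (runs of consecutive edges starting at even resp. odd vertices, the latter
-- completed by 0(k−1)), one of them meets the core t + 1 times.

module Submission where

open import Defs
open import Data.Bool using (Bool; true; false; T; _∧_; _∨_)
open import Data.Bool.Properties using (∧-comm; ∨-comm; T-≡; T-∧)
open import Data.Empty using (⊥; ⊥-elim)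
open import Data.Fin using (Fin; toℕ; fromℕ<; zero; suc)
open import Data.Fin.Properties using (pigeonhole; injective⇒≤; fromℕ<-injective; toℕ-fromℕ<; toℕ-injective)
import Data.Fin.Properties as Finₚ
open import Data.Nat using (ℕ; zero; suc; pred; _+_; _*_; _∸_; _≤_; _<_; NonZero; >-nonZero; z≤n; s≤s; _≡ᵇ_; _<ᵇ_; _≤ᵇ_)
open import Data.Nat.Properties
open import Data.Nat.DivMod using (_%_; _/_; m%n<n; m≡m%n+[m/n]*n; m*n/n≡m; m*n%n≡0; [m+kn]%n≡m%n; +-distrib-/; m≥n⇒m/n>0)
open import Data.Product using (Σ; ∃; ∃₂; _×_; _,_; proj₁; proj₂)
open import Data.Sum using (_⊎_; inj₁; inj₂; [_,_]′)
import Data.Sum as Sum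
open import Data.Vec using (Vec; []; _∷_; _++_)
open import Data.Vec.Relation.Unary.All using (All; []; _∷_)
import Data.Vec.Relation.Unary.All as All
import Data.Vec.Relation.Unary.All.Properties as Allₚ
open import Data.Vec.Relation.Unary.AllPairs using (AllPairs; []; _∷_)
import Data.Vec.Relation.Unary.AllPairs as AllPairs
import Data.Vec.Relation.Unary.AllPairs.Properties as AllPairsₚ
open import Data.Vec.Relation.Unary.Unique.Propositional using (Unique)
open import Data.Vec.Relation.Unary.Unique.Propositional.Properties using (lookup-injective)
open import Function.Base using (id; _∘_; _on_)
open import Function.Bundles using (Equivalence)
open import Function.Definitions using (Injective)
open import Relation.Binary.PropositionalEquality
open import Relation.Nullary using (contradiction)

unique-bounded⇒≤ : ∀ {m Q} {ys : Vec ℕ m} → Unique ys → All (_< Q) ys → m ≤ Q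
unique-bounded⇒≤ {m} {Q} {ys} ys-unique ys<Q = injective⇒≤ {f = bound} bound-injective
  where
  bound : Fin m → Fin Q
  bound i = fromℕ< (Allₚ.lookup⁺ ys<Q i)

  bound-injective : Injective _≡_ _≡_ bound
  bound-injective eq = lookup-injective ys-unique _ _ (fromℕ<-injective _ _ _ _ eq)

module _ {n p q : ℕ} .{{_ : NonZero p}} where

  same-class⇒core : ∀ {x y} → HAdj n p q x y →
                    turanClass p q (toℕ x) ≡ turanClass p q (toℕ y) →
                    toℕ x < q ∸ 1 ⊎ toℕ y < q ∸ 1
  same-class⇒core (_ , inj₁ x<q-1)         _    = inj₁ x<q-1
  same-class⇒core (_ , inj₂ (inj₁ y<q-1))  _    = inj₂ y<q-1
  same-class⇒core (_ , inj₂ (inj₂ x≁y))    x~y  = ⊥-elim (x≁y x~y)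

  two-in-same-class : (c : Fin (suc p) → Fin n) → ∃₂ λ i j →
                      i ≢ j × turanClass p q (toℕ (c i)) ≡ turanClass p q (toℕ (c j))
  two-in-same-class c with pigeonhole (n<1+n p) (λ i → fromℕ< (m%n<n (toℕ (c i) ∸ (q ∸ 1)) p))
  ... | i , j , i<j , same = i , j , Finₚ.<⇒≢ i<j , fromℕ<-injective _ _ _ _ same

  H-clique-meets-core : (c : Fin (suc p) → Fin n) →
                        (∀ {i j} → i ≢ j → HAdj n p q (c i) (c j)) →
                        ∃ λ i → toℕ (c i) < q ∸ 1
  H-clique-meets-core c c-clique with two-in-same-class c
  ... | i , j , i≢j , same = [ (i ,_) , (j ,_) ]′ (same-class⇒core (c-clique i≢j) same)

  H′-clique-meets-core-or-uv : ∀ {u v} (c : Fin (suc p) → Fin n) →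
                               (∀ {i j} → i ≢ j → H′Adj n p q u v (c i) (c j)) →
                               (∃ λ i → toℕ (c i) < q ∸ 1) ⊎ (∃₂ λ i j → c i ≡ u × c j ≡ v)
  H′-clique-meets-core-or-uv c c-clique with two-in-same-class c
  ... | i , j , i≢j , same with c-clique i≢j
  ...   | inj₁ ci~cj = inj₁ ([ (i ,_) , (j ,_) ]′ (same-class⇒core ci~cj same))
  ...   | inj₂ (inj₁ (ci≡u , cj≡v)) = inj₂ (i , j , ci≡u , cj≡v)
  ...   | inj₂ (inj₂ (ci≡v , cj≡u)) = inj₂ (j , i , cj≡u , ci≡v)

∨-swap₄ : ∀ w x y z → (w ∨ x ∨ y ∨ z) ≡ (x ∨ w ∨ z ∨ y)
∨-swap₄ true  true  _ _ = refl
∨-swap₄ true  false _ _ = refl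
∨-swap₄ false true  _ _ = refl
∨-swap₄ false false y z = ∨-comm y z

lolAdjℕ-sym : ∀ k i j → lolAdjℕ k i j ≡ lolAdjℕ k j i
lolAdjℕ-sym k i j = cong₂ _∨_
  (cong₂ _∧_ (∧-comm (i <ᵇ k) (j <ᵇ k))
    (∨-swap₄ (j ≡ᵇ suc i) (i ≡ᵇ suc j)
             ((i ≡ᵇ 0) ∧ (j ≡ᵇ k ∸ 1)) ((j ≡ᵇ 0) ∧ (i ≡ᵇ k ∸ 1))))
  (∨-swap₄ ((i ≡ᵇ 0) ∧ (j ≡ᵇ k)) ((j ≡ᵇ 0) ∧ (i ≡ᵇ k))
           ((k ≤ᵇ i) ∧ (j ≡ᵇ suc i)) ((k ≤ᵇ j) ∧ (i ≡ᵇ suc j)))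

T⇒≡true : ∀ {x} → T x → x ≡ true
T⇒≡true = Equivalence.to T-≡

cycle-step : ∀ {k} z → suc z < k → T (lolAdjℕ k z (suc z))
cycle-step {k} z 1+z<k
  rewrite T⇒≡true (<⇒<ᵇ (<-trans (n<1+n z) 1+z<k)) | T⇒≡true (<⇒<ᵇ 1+z<k)
        | T⇒≡true (≡⇒≡ᵇ z z refl) = _

path-step : ∀ {k} z → k ≤ z → T (lolAdjℕ k z (suc z))
path-step {zero} zero z≤n = _
path-step {k} (suc z) k≤1+z with suc z <ᵇ k in 1+z<ᵇk
... | true  = contradiction (<ᵇ⇒< _ _ (subst T (sym 1+z<ᵇk) _)) (≤⇒≯ k≤1+z)
... | false rewrite T⇒≡true (≤⇒≤ᵇ k≤1+z) | T⇒≡true (≡⇒≡ᵇ z z refl) = _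

closing-step : ∀ {k} → 3 ≤ k → T (lolAdjℕ k 0 (k ∸ 1))
closing-step {suc zero} (s≤s ())
closing-step {suc (suc zero)} (s≤s (s≤s ()))
closing-step {suc (suc (suc k))} _
  rewrite T⇒≡true (<⇒<ᵇ (n<1+n (suc (suc k)))) | T⇒≡true (≡⇒≡ᵇ k k refl) = _

+-suc-suc : ∀ m n → m + suc (suc n) ≡ suc (suc (m + n))
+-suc-suc m n = trans (+-suc m (suc n)) (cong suc (+-suc m n))

module EdgeBlowUp {m : ℕ} (adj : Fin m → Fin m → Bool)
                  (adj-sym : ∀ a b → adj a b ≡ adj b a) (p₀ : ℕ) where

  -- The exponent p is written suc p₀, so the p − 1 fresh vertices of a clique
  -- are indexed by Fin p₀.
  Vertex : Set
  Vertex = BlowVertex m adj (suc p₀)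

  _~_ : Vertex → Vertex → Set
  _~_ = BlowAdj m adj (suc p₀)

  IsEdge : Fin m → Fin m → Set
  IsEdge a b = T (adj a b ∧ (toℕ a <ᵇ toℕ b))

  edge-adj : ∀ {a b} → IsEdge a b → T (adj a b)
  edge-adj = proj₁ ∘ Equivalence.to T-∧

  edge-ordered : ∀ {a b} → IsEdge a b → toℕ a < toℕ b
  edge-ordered = <ᵇ⇒< _ _ ∘ proj₂ ∘ Equivalence.to T-∧

  infix 4 _∈ᶜ_

  data _∈ᶜ_ : Vertex → Fin m × Fin m → Set where
    left  : ∀ {a b} → inj₁ a ∈ᶜ (a , b)
    right : ∀ {a b} → inj₁ b ∈ᶜ (a , b)
    fresh : ∀ {a b e r} → inj₂ ((a , b) , e , r) ∈ᶜ (a , b)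

  clique : ∀ {a b} → IsEdge a b → Fin (suc (suc p₀)) → Vertex
  clique {a} e zero          = inj₁ a
  clique {b = b} e (suc zero) = inj₁ b
  clique e (suc (suc r))     = inj₂ (_ , e , r)

  clique-∈ᶜ : ∀ {a b} (e : IsEdge a b) i → clique e i ∈ᶜ (a , b)
  clique-∈ᶜ e zero          = left
  clique-∈ᶜ e (suc zero)    = right
  clique-∈ᶜ e (suc (suc r)) = fresh

  clique-complete : ∀ {a b} (e : IsEdge a b) {i j} → i ≢ j → clique e i ~ clique e j
  clique-complete e {zero}        {zero}         i≢j = ⊥-elim (i≢j refl)
  clique-complete e {zero}        {suc zero}     _   = orig-orig (edge-adj e)
  clique-complete e {zero}        {suc (suc _)}  _   = orig-new (inj₁ refl)
  clique-complete {a} {b} e {suc zero} {zero} _      = orig-orig (subst T (adj-sym a b) (edge-adj e))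
  clique-complete e {suc zero}    {suc zero}     i≢j = ⊥-elim (i≢j refl)
  clique-complete e {suc zero}    {suc (suc _)}  _   = orig-new (inj₂ refl)
  clique-complete e {suc (suc _)} {zero}         _   = new-orig (inj₁ refl)
  clique-complete e {suc (suc _)} {suc zero}     _   = new-orig (inj₂ refl)
  clique-complete e {suc (suc r)} {suc (suc r′)} i≢j =
    new-new (λ r≡r′ → i≢j (cong (λ r → suc (suc r)) r≡r′))

  -- Each clique vertex is attributed to an endpoint of its edge, so cliques of
  -- disjoint edges contribute vertices with different anchors.
  anchor : Vertex → ℕ
  anchor (inj₁ a)             = toℕ a
  anchor (inj₂ ((a , _) , _)) = toℕ a

  anchor-∈ᶜ : ∀ {x a b} → x ∈ᶜ (a , b) → anchor x ≡ toℕ a ⊎ anchor x ≡ toℕ b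
  anchor-∈ᶜ left  = inj₁ refl
  anchor-∈ᶜ right = inj₂ refl
  anchor-∈ᶜ fresh = inj₁ refl

  shared-pair⇒same-ends : ∀ {x y a b c d} → x ≢ y →
    x ∈ᶜ (a , b) → y ∈ᶜ (a , b) → x ∈ᶜ (c , d) → y ∈ᶜ (c , d) →
    (a ≡ c × b ≡ d) ⊎ (a ≡ d × b ≡ c)
  shared-pair⇒same-ends _   fresh _     fresh _     = inj₁ (refl , refl)
  shared-pair⇒same-ends _   _     fresh _     fresh = inj₁ (refl , refl)
  shared-pair⇒same-ends x≢y left  left  _     _     = ⊥-elim (x≢y refl)
  shared-pair⇒same-ends x≢y right right _     _     = ⊥-elim (x≢y refl)
  shared-pair⇒same-ends x≢y left  right left  left  = ⊥-elim (x≢y refl)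
  shared-pair⇒same-ends x≢y left  right right right = ⊥-elim (x≢y refl)
  shared-pair⇒same-ends _   left  right left  right = inj₁ (refl , refl)
  shared-pair⇒same-ends _   left  right right left  = inj₂ (refl , refl)
  shared-pair⇒same-ends x≢y right left  left  left  = ⊥-elim (x≢y refl)
  shared-pair⇒same-ends x≢y right left  right right = ⊥-elim (x≢y refl)
  shared-pair⇒same-ends _   right left  left  right = inj₂ (refl , refl)
  shared-pair⇒same-ends _   right left  right left  = inj₁ (refl , refl)

  shared-pair⇒same-edge : ∀ {x y a b c d} → IsEdge a b → IsEdge c d → x ≢ y →
    x ∈ᶜ (a , b) → y ∈ᶜ (a , b) → x ∈ᶜ (c , d) → y ∈ᶜ (c , d) → a ≡ c × b ≡ d
  shared-pair⇒same-edge ab cd x≢y xab yab xcd ycd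
    with shared-pair⇒same-ends x≢y xab yab xcd ycd
  ... | inj₁ same          = same
  ... | inj₂ (refl , refl) = ⊥-elim (<-asym (edge-ordered ab) (edge-ordered cd))

  ConsecutiveEdge : ℕ → Set
  ConsecutiveEdge z = Σ (Fin m) λ a → Σ (Fin m) λ b → IsEdge a b × toℕ a ≡ z × toℕ b ≡ suc z

  module Host {n : ℕ} (f : Vertex → Fin n) (Q : ℕ) where

    InCore : Vertex → Set
    InCore x = toℕ (f x) < Q

    CoreHit : Fin m × Fin m → Set
    CoreHit e = Σ Vertex λ x → x ∈ᶜ e × InCore x

    ContainsBoth : Fin n → Fin n → Fin m × Fin m → Set
    ContainsBoth u v e = Σ Vertex λ x → Σ Vertex λ y → x ∈ᶜ e × y ∈ᶜ e × f x ≡ u × f y ≡ v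

    InRange : ℕ → ℕ → Vertex → Set
    InRange lo hi x = lo ≤ anchor x × anchor x < hi

    record Hits (lo hi size : ℕ) : Set where
      field
        lo≤hi    : lo ≤ hi
        vertices : Vec Vertex size
        in-core  : All InCore vertices
        in-range : All (InRange lo hi) vertices
        distinct : AllPairs (_≢_ on anchor) vertices

    open Hits

    hits-bound : Injective _≡_ _≡_ f → ∀ {lo hi size} → Hits lo hi size → size ≤ Q
    hits-bound f-injective h = unique-bounded⇒≤
      (AllPairsₚ.map⁺ (AllPairs.map distinct-values (distinct h))) (Allₚ.map⁺ (in-core h))
      where
      distinct-values : ∀ {x y} → anchor x ≢ anchor y → toℕ (f x) ≢ toℕ (f y)
      distinct-values anchors≢ fx≡fy = anchors≢ (cong anchor (f-injective (toℕ-injective fx≡fy)))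

    no-hits : ∀ {lo hi} → lo ≤ hi → Hits lo hi 0
    no-hits lo≤hi = record { lo≤hi = lo≤hi ; vertices = [] ; in-core = [] ; in-range = [] ; distinct = [] }

    single-hit : ∀ {lo hi x} → InCore x → InRange lo hi x → Hits lo hi 1
    single-hit {x = x} core (lo≤x , x<hi) = record
      { lo≤hi = ≤-trans lo≤x (<⇒≤ x<hi) ; vertices = x ∷ [] ; in-core = core ∷ []
      ; in-range = (lo≤x , x<hi) ∷ [] ; distinct = [] ∷ [] }

    weaken-hits : ∀ {lo lo′ hi hi′ size} → lo′ ≤ lo → hi ≤ hi′ → Hits lo hi size → Hits lo′ hi′ size
    weaken-hits lo′≤lo hi≤hi′ h = record
      { lo≤hi    = ≤-trans lo′≤lo (≤-trans (lo≤hi h) hi≤hi′)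
      ; vertices = vertices h
      ; in-core  = in-core h
      ; distinct = distinct h
      ; in-range = All.map (λ (lo≤x , x<hi) → ≤-trans lo′≤lo lo≤x , <-≤-trans x<hi hi≤hi′) (in-range h) }

    append-hits : ∀ {lo₁ hi₁ lo₂ hi₂ s₁ s₂} → hi₁ ≤ lo₂ →
                  Hits lo₁ hi₁ s₁ → Hits lo₂ hi₂ s₂ → Hits lo₁ hi₂ (s₁ + s₂)
    append-hits {lo₁} {hi₁} {lo₂} {hi₂} hi₁≤lo₂ h₁ h₂ = record
      { lo≤hi    = lo₁≤hi₂
      ; vertices = vertices h₁ ++ vertices h₂
      ; in-core  = Allₚ.++⁺ (in-core h₁) (in-core h₂)
      ; in-range = Allₚ.++⁺ (in-range (weaken-hits ≤-refl hi₁≤hi₂ h₁))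
                            (in-range (weaken-hits lo₁≤lo₂ ≤-refl h₂))
      ; distinct = AllPairsₚ.++⁺ (distinct h₁) (distinct h₂)
          (All.map (λ (_ , x<hi₁) →
                      All.map (λ (lo₂≤y , _) → <⇒≢ (<-≤-trans x<hi₁ (≤-trans hi₁≤lo₂ lo₂≤y))) (in-range h₂))
                   (in-range h₁))
      }
      where
      lo₁≤lo₂ : lo₁ ≤ lo₂
      lo₁≤lo₂ = ≤-trans (lo≤hi h₁) hi₁≤lo₂
      hi₁≤hi₂ : hi₁ ≤ hi₂
      hi₁≤hi₂ = ≤-trans hi₁≤lo₂ (lo≤hi h₂)
      lo₁≤hi₂ : lo₁ ≤ hi₂
      lo₁≤hi₂ = ≤-trans lo₁≤lo₂ (lo≤hi h₂)

    hit-before : ∀ {lo hi s x} → InCore x → anchor x < lo → Hits lo hi s → Hits (anchor x) hi (suc s)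
    hit-before core x<lo h = append-hits x<lo (single-hit core (≤-refl , ≤-refl)) h

    hit-after : ∀ {lo hi s x} → InCore x → hi ≤ anchor x → Hits lo hi s → Hits lo (suc (anchor x)) (suc s)
    hit-after {s = s} core hi≤x h =
      subst (Hits _ _) (+-comm s 1) (append-hits hi≤x h (single-hit core (≤-refl , ≤-refl)))

    append-runs : ∀ {lo₁ hi₁ lo₂ hi₂ s₁ s₂} {X Y : Set} → hi₁ ≤ lo₂ →
                  Hits lo₁ hi₁ s₁ ⊎ X → Hits lo₂ hi₂ s₂ ⊎ Y → Hits lo₁ hi₂ (s₁ + s₂) ⊎ (X ⊎ Y)
    append-runs hi₁≤lo₂ (inj₁ h₁) (inj₁ h₂) = inj₁ (append-hits hi₁≤lo₂ h₁ h₂)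
    append-runs _       (inj₂ x)  _         = inj₂ (inj₁ x)
    append-runs _       (inj₁ _)  (inj₂ y)  = inj₂ (inj₂ y)

    consecutive-hit : ∀ {a b z} → CoreHit (a , b) → toℕ a ≡ z → toℕ b ≡ suc z → Hits z (2 + z) 1
    consecutive-hit {z = z} (x , x∈ab , core) a≡z b≡1+z =
      single-hit core ([ (λ x↦a → at-left  (trans x↦a a≡z))
                       , (λ x↦b → at-right (trans x↦b b≡1+z)) ]′ (anchor-∈ᶜ x∈ab))
      where
      at-left : anchor x ≡ z → InRange z (2 + z) x
      at-left x↦z rewrite x↦z = ≤-refl , s≤s (n≤1+n z)
      at-right : anchor x ≡ suc z → InRange z (2 + z) x
      at-right x↦1+z rewrite x↦1+z = n≤1+n z , ≤-refl

    both-in-one-edge : Injective _≡_ _≡_ f → ∀ {u v a b c d} → u ≢ v →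
                       IsEdge a b → IsEdge c d →
                       ContainsBoth u v (a , b) → ContainsBoth u v (c , d) → a ≡ c × b ≡ d
    both-in-one-edge f-injective u≢v ab cd
      (x , y , xab , yab , refl , refl) (x′ , y′ , xcd , ycd , fx′≡fx , fy′≡fy)
      rewrite f-injective fx′≡fx | f-injective fy′≡fy =
      shared-pair⇒same-edge ab cd (λ x≡y → u≢v (cong f x≡y)) xab yab xcd ycd

    module Runs (Bad : Fin m × Fin m → Set)
                (meets : ∀ {a b} → IsEdge a b → CoreHit (a , b) ⊎ Bad (a , b)) where

      -- The parity of c is kept to tell runs starting at even and at odd vertices apart.
      BadAt : ℕ → Set
      BadAt c = Σ (Fin m) λ a → Σ (Fin m) λ b →
                IsEdge a b × Bad (a , b) × toℕ b ≡ suc (toℕ a) × toℕ a % 2 ≡ c % 2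

      run : ∀ c s → (∀ z → c ≤ z → suc z < c + s * 2 → ConsecutiveEdge z) →
            Hits c (c + s * 2) s ⊎ BadAt c
      run c zero    _     = inj₁ (no-hits (m≤m+n c 0))
      run c (suc s) edges
        with edges c ≤-refl (subst (suc c <_) (sym (+-suc-suc c (s * 2))) (s≤s (s≤s (m≤m+n c _))))
      ... | a , b , e , a≡c , b≡1+c with meets e
      ...   | inj₂ bad = inj₂ (a , b , e , bad , trans b≡1+c (cong suc (sym a≡c)) , cong (_% 2) a≡c)
      ...   | inj₁ hit with run (2 + c) s (λ z 2+c≤z fits → edges z (≤-trans (m≤n+m c 2) 2+c≤z)
                                                     (subst (suc z <_) (sym (+-suc-suc c (s * 2))) fits))
      ...     | inj₂ bad  = inj₂ bad  -- (2 + c) % 2 reduces to c % 2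
      ...     | inj₁ rest = inj₁ (weaken-hits ≤-refl (≤-reflexive (sym (+-suc-suc c (s * 2))))
                                   (append-hits ≤-refl (consecutive-hit hit a≡c b≡1+c) rest))

  H-meets : ∀ {n q} {f : Vertex → Fin n} → (∀ x y → x ~ y → HAdj n (suc p₀) q (f x) (f y)) →
            ∀ {a b} → IsEdge a b → Host.CoreHit f (q ∸ 1) (a , b)
  H-meets {q = q} {f} hom e
    with H-clique-meets-core {q = q} (f ∘ clique e) (λ i≢j → hom _ _ (clique-complete e i≢j))
  ... | i , core = clique e i , clique-∈ᶜ e i , core

  H′-meets : ∀ {n q u v} {f : Vertex → Fin n} →
             (∀ x y → x ~ y → H′Adj n (suc p₀) q u v (f x) (f y)) → ∀ {a b} → IsEdge a b →
             Host.CoreHit f (q ∸ 1) (a , b) ⊎ Host.ContainsBoth f (q ∸ 1) u v (a , b)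
  H′-meets {q = q} {f = f} hom e
    with H′-clique-meets-core-or-uv {q = q} (f ∘ clique e) (λ i≢j → hom _ _ (clique-complete e i≢j))
  ... | inj₁ (i , core)            = inj₁ (clique e i , clique-∈ᶜ e i , core)
  ... | inj₂ (i , j , ci≡u , cj≡v) =
    inj₂ (clique e i , clique e j , clique-∈ᶜ e i , clique-∈ᶜ e j , ci≡u , cj≡v)

module Lollipop (k ℓ p₀ : ℕ) where

  open EdgeBlowUp (lollipopAdj k ℓ) (λ a b → lolAdjℕ-sym k (toℕ a) (toℕ b)) p₀

  edge-between : ∀ {i j} → T (lolAdjℕ k i j) → i < j → j < k + ℓ →
                 Σ (Fin (k + ℓ)) λ a → Σ (Fin (k + ℓ)) λ b → IsEdge a b × toℕ a ≡ i × toℕ b ≡ j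
  edge-between {i} {j} i~j i<j j<k+ℓ = fromℕ< i<k+ℓ , fromℕ< j<k+ℓ , is-edge , toℕ-fromℕ< _ , toℕ-fromℕ< _
    where
    i<k+ℓ : i < k + ℓ
    i<k+ℓ = <-trans i<j j<k+ℓ
    is-edge : IsEdge (fromℕ< i<k+ℓ) (fromℕ< j<k+ℓ)
    is-edge rewrite toℕ-fromℕ< i<k+ℓ | toℕ-fromℕ< j<k+ℓ = Equivalence.from T-∧ (i~j , <⇒<ᵇ i<j)

  cycle-edge : ∀ {z} → suc z < k → ConsecutiveEdge z
  cycle-edge {z} 1+z<k = edge-between (cycle-step z 1+z<k) (n<1+n z) (<-≤-trans 1+z<k (m≤m+n k ℓ))

  path-edge : ∀ {z} → k ≤ z → suc z < k + ℓ → ConsecutiveEdge z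
  path-edge {z} k≤z = edge-between (path-step z k≤z) (n<1+n z)

  closing-edge : 3 ≤ k → Σ (Fin (k + ℓ)) λ a → Σ (Fin (k + ℓ)) λ b →
                 IsEdge a b × toℕ a ≡ 0 × toℕ b ≡ k ∸ 1
  closing-edge 3≤k = edge-between (closing-step 3≤k)
    (≤-trans (s≤s z≤n) (∸-monoˡ-≤ 1 3≤k))
    (<-≤-trans (∸-monoʳ-< {o = 0} (s≤s z≤n) (≤-trans (s≤s z≤n) 3≤k)) (m≤m+n k ℓ))

  module LollipopRuns {n} (f : Vertex → Fin n) (Q : ℕ) (Bad : Fin (k + ℓ) × Fin (k + ℓ) → Set)
                      (meets : ∀ {a b} → IsEdge a b → Host.CoreHit f Q (a , b) ⊎ Bad (a , b)) where
    open Host f Q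
    open Runs Bad meets public

    cycle-run : ∀ c s → c + s * 2 ≤ k → Hits c (c + s * 2) s ⊎ BadAt c
    cycle-run c s fits = run c s λ _ _ z<hi → cycle-edge (<-≤-trans z<hi fits)

    path-run : ∀ c s → k ≤ c → c + s * 2 ≤ k + ℓ → Hits c (c + s * 2) s ⊎ BadAt c
    path-run c s k≤c fits = run c s λ _ c≤z z<hi → path-edge (≤-trans k≤c c≤z) (<-≤-trans z<hi fits)

  module _ {n q} {f : Vertex → Fin n} (hom : ∀ x y → x ~ y → HAdj n (suc p₀) q (f x) (f y)) where
    open Host f (q ∸ 1)
    private
      module R = LollipopRuns f (q ∸ 1) (λ _ → ⊥) (λ e → inj₁ (H-meets {q = q} hom e))

      no-bad : ∀ {c} {A : Set} → R.BadAt c → A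
      no-bad (_ , _ , _ , () , _)

    cycle-hits : ∀ c s → c + s * 2 ≤ k → Hits c (c + s * 2) s
    cycle-hits c s fits = [ id , no-bad {c} ]′ (R.cycle-run c s fits)

    path-hits : ∀ c s → k ≤ c → c + s * 2 ≤ k + ℓ → Hits c (c + s * 2) s
    path-hits c s k≤c fits = [ id , no-bad {c} ]′ (R.path-run c s k≤c fits)

  odd-lollipop-bound : ∀ {n} q s b → 3 ≤ k → k ≡ suc (s * 2) → b * 2 ≤ ℓ →
                       Contains _~_ n (HAdj n (suc p₀) q) → suc s + b ≤ q ∸ 1
  odd-lollipop-bound {n} q s b 3≤k k≡ b*2≤ℓ (f , f-injective , hom) =
    hits-bound f-injective
      (append-hits ≤-refl odd-cycle (path-hits {q = q} hom k b ≤-refl (+-monoʳ-≤ k b*2≤ℓ)))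
    where
    open Host f (q ∸ 1)
    odd-cycle : Hits 0 k (suc s)
    odd-cycle with closing-edge 3≤k
    ... | _ , _ , e , a≡0 , b≡k-1 with H-meets {q = q} hom e
    ...   | x , x∈e , core with anchor-∈ᶜ x∈e
    ...     | inj₁ x↦a = weaken-hits z≤n (≤-reflexive (sym k≡))
                           (hit-before core (s≤s (≤-reflexive (trans x↦a a≡0)))
                                       (cycle-hits {q = q} hom 1 s (≤-reflexive (sym k≡))))
    ...     | inj₂ x↦b = weaken-hits ≤-refl (≤-reflexive (trans (cong suc x↦2s) (sym k≡)))
                           (hit-after core (≤-reflexive (sym x↦2s))
                                      (cycle-hits {q = q} hom 0 s (≤-trans (n≤1+n _) (≤-reflexive (sym k≡)))))
      where
      x↦2s : anchor x ≡ s * 2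
      x↦2s = trans (trans x↦b b≡k-1) (cong (_∸ 1) k≡)

  even-lollipop-bound : ∀ {n} q s b → k ≡ s * 2 → b * 2 ≤ ℓ →
                        Contains _~_ n (HAdj n (suc p₀) q) → s + b ≤ q ∸ 1
  even-lollipop-bound {n} q s b k≡ b*2≤ℓ (f , f-injective , hom) =
    hits-bound f-injective (append-hits (≤-reflexive (sym k≡))
      (cycle-hits {q = q} hom 0 s (≤-reflexive (sym k≡)))
      (path-hits {q = q} hom k b ≤-refl (+-monoʳ-≤ k b*2≤ℓ)))
    where open Host f (q ∸ 1)

  even-odd-bound : ∀ {n u v} q s b → 3 ≤ k → k ≡ s * 2 → ℓ ≡ suc (b * 2) → u ≢ v →
                   Contains _~_ n (H′Adj n (suc p₀) q u v) → s + b ≤ q ∸ 1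
  even-odd-bound _ zero _ 3≤k k≡0 = contradiction (subst (3 ≤_) k≡0 3≤k) λ ()
  even-odd-bound {n} {u} {v} q (suc s) b 3≤k k≡ ℓ≡ u≢v (f , f-injective , hom) =
    conclude matching-even matching-odd
    where
    open Host f (q ∸ 1)
    open LollipopRuns f (q ∸ 1) (ContainsBoth u v) (H′-meets {q = q} hom)

    ClosingBad : Set
    ClosingBad = Σ (Fin (k + ℓ)) λ a → Σ (Fin (k + ℓ)) λ b →
                 IsEdge a b × ContainsBoth u v (a , b) × toℕ a ≡ 0 × toℕ b ≡ k ∸ 1

    b*2≤ℓ : b * 2 ≤ ℓ
    b*2≤ℓ = ≤-trans (n≤1+n _) (≤-reflexive (sym ℓ≡))

    k-even : k % 2 ≡ 0
    k-even = trans (cong (_% 2) k≡) (m*n%n≡0 (suc s) 2)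

    1+k-odd : suc k % 2 ≡ 1
    1+k-odd = trans (cong (λ k → suc k % 2) k≡) ([m+kn]%n≡m%n 1 s 2)

    matching-even : Hits 0 (k + b * 2) (suc s + b) ⊎ BadAt 0
    matching-even = Sum.map₂
      [ id , (λ (a , b , e , both , b≡1+a , a≡k) → a , b , e , both , b≡1+a , trans a≡k k-even) ]′
      (append-runs (≤-reflexive (sym k≡))
        (cycle-run 0 (suc s) (≤-reflexive (sym k≡)))
        (path-run k b ≤-refl (+-monoʳ-≤ k b*2≤ℓ)))

    closing-cycle : Hits 0 k (suc s) ⊎ (BadAt 1 ⊎ ClosingBad)
    closing-cycle with closing-edge 3≤k
    ... | a , b′ , e , a≡0 , b≡k-1 with H′-meets {q = q} hom e
    ...   | inj₂ both = inj₂ (inj₂ (a , b′ , e , both , a≡0 , b≡k-1))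
    ...   | inj₁ (x , x∈e , core)
      with cycle-run 1 s (≤-trans (n≤1+n _) (≤-reflexive (sym k≡))) | anchor-∈ᶜ x∈e
    ...     | inj₂ bad    | _        = inj₂ (inj₁ bad)
    ...     | inj₁ middle | inj₁ x↦a = inj₁ (weaken-hits z≤n (≤-trans (n≤1+n _) (≤-reflexive (sym k≡)))
                                         (hit-before core (s≤s (≤-reflexive (trans x↦a a≡0))) middle))
    ...     | inj₁ middle | inj₂ x↦b = inj₁ (weaken-hits z≤n (≤-reflexive (trans (cong suc x↦k-1) (sym k≡)))
                                         (hit-after core (≤-reflexive (sym x↦k-1)) middle))
      where
      x↦k-1 : anchor x ≡ suc (s * 2)
      x↦k-1 = trans (trans x↦b b≡k-1) (cong (_∸ 1) k≡)

    matching-odd : Hits 0 (suc k + b * 2) (suc s + b) ⊎ (BadAt 1 ⊎ ClosingBad)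
    matching-odd = Sum.map₂
      [ id , (λ (a , b , e , both , b≡1+a , a≡1+k) → inj₁ (a , b , e , both , b≡1+a , trans a≡1+k 1+k-odd)) ]′
      (append-runs (n≤1+n k) closing-cycle
        (path-run (suc k) b (n≤1+n k)
          (≤-reflexive (trans (sym (+-suc k (b * 2))) (cong (k +_) (sym ℓ≡))))))

    -- If neither matching meets the core often enough, both contain the edge
    -- carrying uv; parity, resp. k ≥ 3, rules this out.
    conclude : Hits 0 (k + b * 2) (suc s + b) ⊎ BadAt 0 →
               Hits 0 (suc k + b * 2) (suc s + b) ⊎ (BadAt 1 ⊎ ClosingBad) → suc s + b ≤ q ∸ 1
    conclude (inj₁ hits) _ = hits-bound f-injective hits
    conclude _ (inj₁ hits) = hits-bound f-injective hits
    conclude (inj₂ (a , b , ab , both , b≡1+a , a-even)) (inj₂ (inj₁ (c , d , cd , both′ , _ , c-odd)))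
      with both-in-one-edge f-injective u≢v ab cd both both′
    ... | refl , refl = contradiction (trans (sym a-even) c-odd) 0≢1+n
    conclude (inj₂ (a , b , ab , both , b≡1+a , _)) (inj₂ (inj₂ (c , d , cd , both′ , c≡0 , d≡k-1)))
      with both-in-one-edge f-injective u≢v ab cd both both′
    ... | refl , refl = contradiction 3≤k (≤⇒≯ (≤-trans (m≤n+m∸n k 1) (≤-reflexive (cong suc k-1≡1))))
      where
      k-1≡1 : k ∸ 1 ≡ 1
      k-1≡1 = trans (sym d≡k-1) (trans b≡1+a (cong suc c≡0))

odd-form : ∀ {k} → k % 2 ≡ 1 → k ≡ suc (k / 2 * 2)
odd-form {k} k-odd = trans (m≡m%n+[m/n]*n k 2) (cong (_+ k / 2 * 2) k-odd)

even-form : ∀ {k} → 2 ≤ k → k % 2 ≡ 0 → ∃ λ s → k ≡ suc s * 2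
even-form {k} 2≤k k-even = pred (k / 2) , (begin
  k                      ≡⟨ m≡m%n+[m/n]*n k 2 ⟩
  k % 2 + k / 2 * 2      ≡⟨ cong (_+ k / 2 * 2) k-even ⟩
  k / 2 * 2              ≡⟨ cong (_* 2) (sym (suc-pred (k / 2) {{>-nonZero (m≥n⇒m/n>0 2≤k)}})) ⟩
  suc (pred (k / 2)) * 2 ∎)
  where open ≡-Reasoning

half-pred-odd : ∀ {k} s → k ≡ suc (s * 2) → (k ∸ 1) / 2 ≡ s
half-pred-odd s refl = m*n/n≡m s 2

half-pred-even : ∀ {k} s → k ≡ suc s * 2 → (k ∸ 1) / 2 ≡ s
half-pred-even s refl =
  trans (+-distrib-/ 1 (s * 2) (subst (λ r → 1 + r < 2) (sym (m*n%n≡0 s 2)) ≤-refl)) (m*n/n≡m s 2)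

module _ {k ℓ p₀ n : ℕ} (3≤k : 3 ≤ k) (2≤ℓ : 2 ≤ ℓ) where
  open ≤-Reasoning
  open Lollipop k ℓ p₀

  odd-odd-free : k % 2 ≡ 1 → ℓ % 2 ≡ 1 →
                 LollipopBlowupFree k ℓ (suc p₀) n (HAdj n (suc p₀) (tval k ℓ + 1))
  odd-odd-free k-odd ℓ-odd embedding = 1+n≰n (begin
    suc (tval k ℓ)
      ≡⟨ cong suc (cong₂ _+_ (half-pred-odd (k / 2) k≡) (half-pred-odd (ℓ / 2) ℓ≡)) ⟩
    suc (k / 2 + ℓ / 2)
      ≤⟨ odd-lollipop-bound (tval k ℓ + 1) (k / 2) (ℓ / 2) 3≤k k≡
                            (≤-trans (n≤1+n _) (≤-reflexive (sym ℓ≡))) embedding ⟩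
    tval k ℓ + 1 ∸ 1
      ≡⟨ m+n∸n≡m (tval k ℓ) 1 ⟩
    tval k ℓ ∎)
    where
    k≡ : k ≡ suc (k / 2 * 2)
    k≡ = odd-form k-odd
    ℓ≡ : ℓ ≡ suc (ℓ / 2 * 2)
    ℓ≡ = odd-form ℓ-odd

  odd-even-free : k % 2 ≡ 1 → ℓ % 2 ≡ 0 →
                  LollipopBlowupFree k ℓ (suc p₀) n (HAdj n (suc p₀) (tval k ℓ + 2))
  odd-even-free k-odd ℓ-even embedding with even-form 2≤ℓ ℓ-even
  ... | b , ℓ≡ = 1+n≰n (begin
    suc (suc (tval k ℓ))
      ≡⟨ cong (2 +_) (cong₂ _+_ (half-pred-odd (k / 2) k≡) (half-pred-even b ℓ≡)) ⟩
    suc (suc (k / 2 + b))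
      ≡⟨ cong suc (sym (+-suc (k / 2) b)) ⟩
    suc (k / 2 + suc b)
      ≤⟨ odd-lollipop-bound (tval k ℓ + 2) (k / 2) (suc b) 3≤k k≡ (≤-reflexive (sym ℓ≡)) embedding ⟩
    tval k ℓ + 2 ∸ 1
      ≡⟨ cong (_∸ 1) (+-comm (tval k ℓ) 2) ⟩
    suc (tval k ℓ) ∎)
    where
    k≡ : k ≡ suc (k / 2 * 2)
    k≡ = odd-form k-odd

  even-odd-free : k % 2 ≡ 0 → ℓ % 2 ≡ 1 → (u v : Fin n) → IsH′Edge n (suc p₀) (tval k ℓ + 1) u v →
                  LollipopBlowupFree k ℓ (suc p₀) n (H′Adj n (suc p₀) (tval k ℓ + 1) u v)
  even-odd-free k-even ℓ-odd u v uv-edge embedding with even-form (≤-trans (n≤1+n 2) 3≤k) k-even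
  ... | s , k≡ = 1+n≰n (begin
    suc (tval k ℓ)
      ≡⟨ cong suc (cong₂ _+_ (half-pred-even s k≡) (half-pred-odd (ℓ / 2) ℓ≡)) ⟩
    suc s + ℓ / 2
      ≤⟨ even-odd-bound (tval k ℓ + 1) (suc s) (ℓ / 2) 3≤k k≡ ℓ≡ (proj₁ uv-edge) embedding ⟩
    tval k ℓ + 1 ∸ 1
      ≡⟨ m+n∸n≡m (tval k ℓ) 1 ⟩
    tval k ℓ ∎)
    where
    ℓ≡ : ℓ ≡ suc (ℓ / 2 * 2)
    ℓ≡ = odd-form ℓ-odd

  even-even-free : k % 2 ≡ 0 → ℓ % 2 ≡ 0 →
                   LollipopBlowupFree k ℓ (suc p₀) n (HAdj n (suc p₀) (tval k ℓ + 2))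
  even-even-free k-even ℓ-even embedding
    with even-form (≤-trans (n≤1+n 2) 3≤k) k-even | even-form 2≤ℓ ℓ-even
  ... | s , k≡ | b , ℓ≡ = 1+n≰n (begin
    suc (suc (tval k ℓ))
      ≡⟨ cong (2 +_) (cong₂ _+_ (half-pred-even s k≡) (half-pred-even b ℓ≡)) ⟩
    suc (suc (s + b))
      ≡⟨ cong suc (sym (+-suc s b)) ⟩
    suc s + suc b
      ≤⟨ even-lollipop-bound (tval k ℓ + 2) (suc s) (suc b) k≡ (≤-reflexive (sym ℓ≡)) embedding ⟩
    tval k ℓ + 2 ∸ 1
      ≡⟨ cong (_∸ 1) (+-comm (tval k ℓ) 2) ⟩
    suc (tval k ℓ) ∎)

lemma3p2 : (k ℓ p : ℕ) → 3 ≤ k → 2 ≤ ℓ → 2 ≤ p → .{{_ : NonZero p}} →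
    Σ ℕ λ N → (n : ℕ) → N ≤ n →
      ((k % 2 ≡ 1 → ℓ % 2 ≡ 1 →
          LollipopBlowupFree k ℓ p n (HAdj n p (tval k ℓ + 1))) ×
       (k % 2 ≡ 1 → ℓ % 2 ≡ 0 →
          LollipopBlowupFree k ℓ p n (HAdj n p (tval k ℓ + 2))) ×
       (k % 2 ≡ 0 → ℓ % 2 ≡ 1 → (u v : Fin n) →
          IsH′Edge n p (tval k ℓ + 1) u v →
          LollipopBlowupFree k ℓ p n (H′Adj n p (tval k ℓ + 1) u v)) ×
       (k % 2 ≡ 0 → ℓ % 2 ≡ 0 →
          LollipopBlowupFree k ℓ p n (HAdj n p (tval k ℓ + 2))))
-- No largeness of n is needed: the bounds hold for every n.
lemma3p2 k ℓ (suc p₀) 3≤k 2≤ℓ _ = 0 , λ n _ →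
  odd-odd-free 3≤k 2≤ℓ , odd-even-free 3≤k 2≤ℓ , even-odd-free 3≤k 2≤ℓ , even-even-free 3≤k 2≤ℓ
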